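{- Let $\mathcal{T}_{\mathrm{Sch}}$ be the generating tree of the succession rule (NewSch): the root is labelled $(1,1)$, and a vertex labelled $(h,k)$ has children with labels $$(1,k+1),(2,k+1),\ldots,(h,k+1),\ (2,1),(2,2),\ldots,(2,k-1),\ (h+1,k).$$ For $n\ge1$, let $c_n$ be the number of vertices of $\mathcal{T}_{\mathrm{Sch}}$ at depth $n$. Then $(c_n)_{n\ge1}$ is the sequence of large Schröder numbers, that is, $$\sum_{n\ge1}c_nx^{n-1}=\frac{1-x-\sqrt{1-6x+x^2}}{2x}.$$ In particular, $c_1,c_2,\ldots=1,2,6,22,90,\ldots$.
   Context: A succession rule consists of a root label and, for each label, a list (with multiplicities) of the labels of its children. It determines an infinite rooted labelled tree: the root, at depth $1$, carries the root label, and every vertex with label $\lambda$ has one child for each label in the production of $\lambda$. The enumeration sequence of the rule is the sequence of the numbers of vertices at each depth. -}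

module Defs where

open import Data.Nat using (ℕ; zero; suc; _+_; _*_; _∸_)
open import Data.Product using (_×_; _,_)
open import Data.List using (List; []; _∷_; _++_; map; concatMap; length; zipWith; reverse)
open import Data.Nat.ListAction using (sum)

Label : Set
Label = ℕ × ℕ

oneTo : ℕ → List ℕ
oneTo zero    = []
oneTo (suc m) = oneTo m ++ (suc m ∷ [])

children : Label → List Label
children (h , k) =
  map (λ i → (i , suc k)) (oneTo h)
  ++ map (λ j → (2 , j)) (oneTo (k ∸ 1))
  ++ ((suc h , k) ∷ [])

-- Multiset (as a list) of labels at generation n, the root generation being 0.
generation : ℕ → List Label
generation zero    = (1 , 1) ∷ []
generation (suc n) = concatMap children (generation n)

-- c n = number of vertices of the generating tree at depth n (root at depth 1);
-- c 0 = 0 by convention (there is no depth 0).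
c : ℕ → ℕ
c zero    = 0
c (suc n) = length (generation n)

-- Large Schröder numbers r_0, r_1, … = 1, 2, 6, 22, 90, …, defined by
-- r_0 = 1,  r_{n+1} = r_n + Σ_{k=0}^{n} r_k r_{n-k},
-- i.e. the coefficients of the unique power series R(x) with R = 1 + x R + x R²,
-- which is (1 - x - √(1 - 6x + x²)) / (2x).
hd : List ℕ → ℕ
hd []      = 0
hd (x ∷ _) = x

-- schTable n = [r_n, r_{n-1}, …, r_0]
schTable : ℕ → List ℕ
schTable zero    = 1 ∷ []
schTable (suc n) = (hd t + sum (zipWith _*_ t (reverse t))) ∷ t
  where t = schTable n

largeSchröder : ℕ → ℕ
largeSchröder n = hd (schTable n)

{-# OPTIONS --safe #-}
module Submission where

-- The number of descendants n generations below a vertex (h + 1 , k + 1)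
-- depends only on ℓ = h + k, and these numbers are the level sizes of the one-dimensional
-- rule (ℓ) ↝ (1)(2)⋯(ℓ + 1)(ℓ + 1). For that rule, 2^ℓ times the n-th level size below ℓ
-- is the coefficient of xⁿ in R (1 + R)^ℓ, where R = 1 + x R (1 + R) is the series of
-- large Schröder numbers: both arrays satisfy one recurrence in (n , ℓ), and that
-- recurrence determines the array. The root (1 , 1) has ℓ = 0, so c (n + 1) = [xⁿ] R.

open import Defs
open import Data.Nat using (ℕ; zero; suc; _+_; _*_; _^_; _≤_; _∸_)
open import Data.Nat.Properties
  using (+-identityʳ; +-assoc; +-comm; +-suc; +-cancelʳ-≡; *-identityˡ; *-identityʳ; *-comm; *-assoc; *-distribˡ-+; *-distribʳ-+)
open import Data.Nat.ListAction using (sum)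
open import Data.Nat.ListAction.Properties using (sum-++)
open import Data.Nat.Solver using (module +-*-Solver)
open import Data.Product using (_,_)
open import Data.List using (List; []; _∷_; _∷ʳ_; _++_; map; concatMap; length; zipWith; reverse; applyUpTo; applyDownFrom)
open import Data.List.Properties using (map-++; map-∘; zipWith-comm; unfold-reverse; applyUpTo-∷ʳ)
open import Function using (_∘_)
open import Relation.Binary.PropositionalEquality using (_≡_; _≗_; refl; sym; trans; cong; cong₂; module ≡-Reasoning)

open +-*-Solver using (solve; _:+_; _:*_; _:=_; con)

sum-map-++ : ∀ {A : Set} (f : A → ℕ) xs ys → sum (map f (xs ++ ys)) ≡ sum (map f xs) + sum (map f ys)
sum-map-++ f xs ys = trans (cong sum (map-++ f xs ys)) (sum-++ (map f xs) (map f ys))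

sum-map-concatMap : ∀ {A B : Set} (f : B → ℕ) (g : A → List B) xs →
                    sum (map f (concatMap g xs)) ≡ sum (map (sum ∘ map f ∘ g) xs)
sum-map-concatMap f g []       = refl
sum-map-concatMap f g (x ∷ xs) =
  trans (sum-map-++ f (g x) (concatMap g xs)) (cong (sum (map f (g x)) +_) (sum-map-concatMap f g xs))

sum-map-oneTo-suc : ∀ (f : ℕ → ℕ) m → sum (map f (oneTo (suc m))) ≡ sum (map f (oneTo m)) + f (suc m)
sum-map-oneTo-suc f m = trans (sum-map-++ f (oneTo m) (suc m ∷ [])) (cong (sum (map f (oneTo m)) +_) (+-identityʳ (f (suc m))))

sum-map-oneTo-cong : ∀ {f g : ℕ → ℕ} → f ∘ suc ≗ g ∘ suc → ∀ m → sum (map f (oneTo m)) ≡ sum (map g (oneTo m))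
sum-map-oneTo-cong f≗g zero    = refl
sum-map-oneTo-cong {f} {g} f≗g (suc m) = begin
  sum (map f (oneTo (suc m)))       ≡⟨ sum-map-oneTo-suc f m ⟩
  sum (map f (oneTo m)) + f (suc m) ≡⟨ cong₂ _+_ (sum-map-oneTo-cong f≗g m) (f≗g m) ⟩
  sum (map g (oneTo m)) + g (suc m) ≡⟨ sum-map-oneTo-suc g m ⟨
  sum (map g (oneTo (suc m)))       ∎
  where open ≡-Reasoning

sum-map-oneTo-+ : ∀ (f : ℕ → ℕ) n m →
                  sum (map f (oneTo (n + m))) ≡ sum (map f (oneTo m)) + sum (map (λ i → f (i + m)) (oneTo n))
sum-map-oneTo-+ f zero    m = sym (+-identityʳ _)
sum-map-oneTo-+ f (suc n) m = begin
  sum (map f (oneTo (suc n + m)))                       ≡⟨ sum-map-oneTo-suc f (n + m) ⟩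
  sum (map f (oneTo (n + m))) + f (suc n + m)           ≡⟨ cong (_+ f (suc n + m)) (sum-map-oneTo-+ f n m) ⟩
  (sum (map f (oneTo m)) + shifted n) + f (suc n + m)   ≡⟨ +-assoc (sum (map f (oneTo m))) _ _ ⟩
  sum (map f (oneTo m)) + (shifted n + f (suc n + m))   ≡⟨ cong (sum (map f (oneTo m)) +_) (sum-map-oneTo-suc (λ i → f (i + m)) n) ⟨
  sum (map f (oneTo m)) + shifted (suc n)               ∎
  where
  open ≡-Reasoning
  shifted : ℕ → ℕ
  shifted k = sum (map (λ i → f (i + m)) (oneTo k))

module _ {A : Set} (rule : A → List A) where

  levelSize : ℕ → A → ℕ
  levelSize zero    _ = 1
  levelSize (suc n) x = sum (map (levelSize n) (rule x))

  length≡sum-map-levelSize-zero : ∀ xs → length xs ≡ sum (map (levelSize 0) xs)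
  length≡sum-map-levelSize-zero []       = refl
  length≡sum-map-levelSize-zero (x ∷ xs) = cong suc (length≡sum-map-levelSize-zero xs)

sum-map-levelSize-generation : ∀ n m → sum (map (levelSize children m) (generation n)) ≡ levelSize children (n + m) (1 , 1)
sum-map-levelSize-generation zero    m = +-identityʳ _
sum-map-levelSize-generation (suc n) m = begin
  sum (map (levelSize children m) (concatMap children (generation n)))
    ≡⟨ sum-map-concatMap (levelSize children m) children (generation n) ⟩
  sum (map (levelSize children (suc m)) (generation n))
    ≡⟨ sum-map-levelSize-generation n (suc m) ⟩
  levelSize children (n + suc m) (1 , 1)
    ≡⟨ cong (λ k → levelSize children k (1 , 1)) (+-suc n m) ⟩
  levelSize children (suc n + m) (1 , 1)
    ∎
  where open ≡-Reasoning

length-generation : ∀ n → length (generation n) ≡ levelSize children n (1 , 1)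
length-generation n = begin
  length (generation n)                          ≡⟨ length≡sum-map-levelSize-zero children (generation n) ⟩
  sum (map (levelSize children 0) (generation n)) ≡⟨ sum-map-levelSize-generation n 0 ⟩
  levelSize children (n + 0) (1 , 1)             ≡⟨ cong (λ k → levelSize children k (1 , 1)) (+-identityʳ n) ⟩
  levelSize children n (1 , 1)                   ∎
  where open ≡-Reasoning

children₁ : ℕ → List ℕ
children₁ ℓ = oneTo (suc ℓ) ++ suc ℓ ∷ []

sum-map-children : ∀ (f : Label → ℕ) h k →
  sum (map f (children (h , k)))
    ≡ sum (map (λ i → f (i , suc k)) (oneTo h)) + sum (map (λ j → f (2 , j)) (oneTo (k ∸ 1))) + f (suc h , k)
sum-map-children f h k = begin
  sum (map f (left ++ middle ++ (suc h , k) ∷ []))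
    ≡⟨ sum-map-++ f left _ ⟩
  sum (map f left) + sum (map f (middle ++ (suc h , k) ∷ []))
    ≡⟨ cong (sum (map f left) +_) (sum-map-++ f middle _) ⟩
  sum (map f left) + (sum (map f middle) + (f (suc h , k) + 0))
    ≡⟨ cong₂ (λ a b → a + (b + (f (suc h , k) + 0))) (cong sum (map-∘ (oneTo h))) (cong sum (map-∘ (oneTo (k ∸ 1)))) ⟨
  a + (b + (f (suc h , k) + 0))
    ≡⟨ solve 3 (λ a b c → a :+ (b :+ (c :+ con 0)) := a :+ b :+ c) refl a b (f (suc h , k)) ⟩
  a + b + f (suc h , k)
    ∎
  where
  open ≡-Reasoning
  left middle : List Label
  left   = map (λ i → (i , suc k)) (oneTo h)
  middle = map (λ j → (2 , j)) (oneTo (k ∸ 1))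
  a b : ℕ
  a = sum (map (λ i → f (i , suc k)) (oneTo h))
  b = sum (map (λ j → f (2 , j)) (oneTo (k ∸ 1)))

sum-map-children₁ : ∀ (f : ℕ → ℕ) ℓ → sum (map f (children₁ ℓ)) ≡ sum (map f (oneTo (suc ℓ))) + f (suc ℓ)
sum-map-children₁ f ℓ =
  trans (sum-map-++ f (oneTo (suc ℓ)) (suc ℓ ∷ [])) (cong (sum (map f (oneTo (suc ℓ))) +_) (+-identityʳ (f (suc ℓ))))

levelSize-children : ∀ n h k → levelSize children n (suc h , suc k) ≡ levelSize children₁ n (h + k)
levelSize-children zero    h k = refl
levelSize-children (suc n) h k = begin
  sum (map W (children (suc h , suc k)))
    ≡⟨ sum-map-children W (suc h) (suc k) ⟩
  sum (map (λ i → W (i , suc (suc k))) (oneTo (suc h))) + sum (map (λ j → W (2 , j)) (oneTo k)) + W (suc (suc h) , suc k)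
    ≡⟨ cong₂ _+_ (cong₂ _+_
         (sum-map-oneTo-cong (λ i → trans (levelSize-children n i (suc k)) (cong G (+-suc i k))) (suc h))
         (sum-map-oneTo-cong (levelSize-children n 1) k))
         (levelSize-children n (suc h) k) ⟩
  sum (map (λ i → G (i + k)) (oneTo (suc h))) + sum (map G (oneTo k)) + G (suc h + k)
    ≡⟨ cong (_+ G (suc h + k)) (+-comm (sum (map (λ i → G (i + k)) (oneTo (suc h)))) _) ⟩
  sum (map G (oneTo k)) + sum (map (λ i → G (i + k)) (oneTo (suc h))) + G (suc h + k)
    ≡⟨ cong (_+ G (suc h + k)) (sum-map-oneTo-+ G (suc h) k) ⟨
  sum (map G (oneTo (suc h + k))) + G (suc h + k)
    ≡⟨ sum-map-children₁ G (h + k) ⟨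
  sum (map G (children₁ (h + k)))
    ∎
  where
  open ≡-Reasoning
  W : Label → ℕ
  W = levelSize children n
  G : ℕ → ℕ
  G = levelSize children₁ n

levelSize-children₁-step : ∀ n ℓ →
  levelSize children₁ (suc n) (suc ℓ) + levelSize children₁ n (suc ℓ)
    ≡ levelSize children₁ (suc n) ℓ + 2 * levelSize children₁ n (suc (suc ℓ))
levelSize-children₁-step n ℓ = begin
  sum (map G (children₁ (suc ℓ))) + G (suc ℓ)
    ≡⟨ cong (_+ G (suc ℓ)) (sum-map-children₁ G (suc ℓ)) ⟩
  sum (map G (oneTo (suc (suc ℓ)))) + G (suc (suc ℓ)) + G (suc ℓ)
    ≡⟨ cong (λ a → a + G (suc (suc ℓ)) + G (suc ℓ)) (sum-map-oneTo-suc G (suc ℓ)) ⟩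
  s + G (suc (suc ℓ)) + G (suc (suc ℓ)) + G (suc ℓ)
    ≡⟨ solve 3 (λ s a b → s :+ b :+ b :+ a := s :+ a :+ con 2 :* b) refl s (G (suc ℓ)) (G (suc (suc ℓ))) ⟩
  s + G (suc ℓ) + 2 * G (suc (suc ℓ))
    ≡⟨ cong (_+ 2 * G (suc (suc ℓ))) (sum-map-children₁ G ℓ) ⟨
  sum (map G (children₁ ℓ)) + 2 * G (suc (suc ℓ))
    ∎
  where
  open ≡-Reasoning
  G : ℕ → ℕ
  G = levelSize children₁ n
  s : ℕ
  s = sum (map G (oneTo (suc ℓ)))

record SchröderRecurrence (a : ℕ → ℕ → ℕ) : Set where
  field
    top  : ∀ ℓ → a 0 ℓ ≡ 2 ^ ℓ
    left : ∀ n → a (suc n) 0 ≡ a n 1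
    step : ∀ n ℓ → a (suc n) (suc ℓ) + a n (suc ℓ) ≡ 2 * a (suc n) ℓ + a n (suc (suc ℓ))

SchröderRecurrence-unique : ∀ {a b} → SchröderRecurrence a → SchröderRecurrence b → ∀ n ℓ → a n ℓ ≡ b n ℓ
SchröderRecurrence-unique {a} {b} A B = unique
  where
  module A = SchröderRecurrence A
  module B = SchröderRecurrence B
  open ≡-Reasoning
  unique : ∀ n ℓ → a n ℓ ≡ b n ℓ
  unique zero    ℓ       = trans (A.top ℓ) (sym (B.top ℓ))
  unique (suc n) zero    = trans (A.left n) (trans (unique n 1) (sym (B.left n)))
  unique (suc n) (suc ℓ) = +-cancelʳ-≡ (a n (suc ℓ)) _ _ (begin
    a (suc n) (suc ℓ) + a n (suc ℓ)      ≡⟨ A.step n ℓ ⟩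
    2 * a (suc n) ℓ + a n (suc (suc ℓ))  ≡⟨ cong₂ (λ u v → 2 * u + v) (unique (suc n) ℓ) (unique n (suc (suc ℓ))) ⟩
    2 * b (suc n) ℓ + b n (suc (suc ℓ))  ≡⟨ B.step n ℓ ⟨
    b (suc n) (suc ℓ) + b n (suc ℓ)      ≡⟨ cong (b (suc n) (suc ℓ) +_) (unique n (suc ℓ)) ⟨
    b (suc n) (suc ℓ) + a n (suc ℓ)      ∎)

scaledLevelSize-recurrence : SchröderRecurrence (λ n ℓ → 2 ^ ℓ * levelSize children₁ n ℓ)
scaledLevelSize-recurrence = record
  { top  = λ ℓ → *-identityʳ (2 ^ ℓ)
  ; left = λ n → *-identityˡ (levelSize children₁ (suc n) 0)  -- children₁ 0 is 1 ∷ 1 ∷ []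
  ; step = step
  }
  where
  open ≡-Reasoning
  step : ∀ n ℓ → 2 ^ suc ℓ * levelSize children₁ (suc n) (suc ℓ) + 2 ^ suc ℓ * levelSize children₁ n (suc ℓ)
                 ≡ 2 * (2 ^ ℓ * levelSize children₁ (suc n) ℓ) + 2 ^ suc (suc ℓ) * levelSize children₁ n (suc (suc ℓ))
  step n ℓ = begin
    2 ^ suc ℓ * G (suc n) (suc ℓ) + 2 ^ suc ℓ * G n (suc ℓ)
      ≡⟨ *-distribˡ-+ (2 ^ suc ℓ) (G (suc n) (suc ℓ)) (G n (suc ℓ)) ⟨
    2 ^ suc ℓ * (G (suc n) (suc ℓ) + G n (suc ℓ))
      ≡⟨ cong (2 ^ suc ℓ *_) (levelSize-children₁-step n ℓ) ⟩
    2 * 2 ^ ℓ * (G (suc n) ℓ + 2 * G n (suc (suc ℓ)))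
      ≡⟨ solve 3 (λ p x y → con 2 :* p :* (x :+ con 2 :* y) := con 2 :* (p :* x) :+ con 2 :* (con 2 :* p) :* y)
           refl (2 ^ ℓ) (G (suc n) ℓ) (G n (suc (suc ℓ))) ⟩
    2 * (2 ^ ℓ * G (suc n) ℓ) + 2 ^ suc (suc ℓ) * G n (suc (suc ℓ))
      ∎
    where
    G : ℕ → ℕ → ℕ
    G = levelSize children₁

Series : Set
Series = ℕ → ℕ

infixl 6 _⊕_
infixl 7 _⊛_ _·_

_⊕_ : Series → Series → Series
(f ⊕ g) n = f n + g n

_·_ : ℕ → Series → Series
(a · f) n = a * f n

_⊛_ : Series → Series → Series
(f ⊛ g) zero    = f 0 * g 0
(f ⊛ g) (suc n) = f 0 * g (suc n) + (f ∘ suc ⊛ g) n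

⊛-congʳ : ∀ {f g} h → f ≗ g → f ⊛ h ≗ g ⊛ h
⊛-congʳ h f≗g zero    = cong (_* h 0) (f≗g 0)
⊛-congʳ h f≗g (suc n) = cong₂ _+_ (cong (_* h (suc n)) (f≗g 0)) (⊛-congʳ h (f≗g ∘ suc) n)

⊛-distribˡ-⊕ : ∀ f g h → f ⊛ (g ⊕ h) ≗ f ⊛ g ⊕ f ⊛ h
⊛-distribˡ-⊕ f g h zero    = *-distribˡ-+ (f 0) (g 0) (h 0)
⊛-distribˡ-⊕ f g h (suc n) = begin
  f 0 * (g (suc n) + h (suc n)) + (f ∘ suc ⊛ (g ⊕ h)) n
    ≡⟨ cong₂ _+_ (*-distribˡ-+ (f 0) (g (suc n)) (h (suc n))) (⊛-distribˡ-⊕ (f ∘ suc) g h n) ⟩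
  (f 0 * g (suc n) + f 0 * h (suc n)) + ((f ∘ suc ⊛ g) n + (f ∘ suc ⊛ h) n)
    ≡⟨ solve 4 (λ a b c d → (a :+ b) :+ (c :+ d) := (a :+ c) :+ (b :+ d)) refl
         (f 0 * g (suc n)) (f 0 * h (suc n)) ((f ∘ suc ⊛ g) n) ((f ∘ suc ⊛ h) n) ⟩
  (f ⊛ g) (suc n) + (f ⊛ h) (suc n)
    ∎
  where open ≡-Reasoning

⊛-distribʳ-⊕ : ∀ h f g → (f ⊕ g) ⊛ h ≗ f ⊛ h ⊕ g ⊛ h
⊛-distribʳ-⊕ h f g zero    = *-distribʳ-+ (h 0) (f 0) (g 0)
⊛-distribʳ-⊕ h f g (suc n) = begin
  (f 0 + g 0) * h (suc n) + ((f ∘ suc ⊕ g ∘ suc) ⊛ h) n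
    ≡⟨ cong₂ _+_ (*-distribʳ-+ (h (suc n)) (f 0) (g 0)) (⊛-distribʳ-⊕ h (f ∘ suc) (g ∘ suc) n) ⟩
  (f 0 * h (suc n) + g 0 * h (suc n)) + ((f ∘ suc ⊛ h) n + (g ∘ suc ⊛ h) n)
    ≡⟨ solve 4 (λ a b c d → (a :+ b) :+ (c :+ d) := (a :+ c) :+ (b :+ d)) refl
         (f 0 * h (suc n)) (g 0 * h (suc n)) ((f ∘ suc ⊛ h) n) ((g ∘ suc ⊛ h) n) ⟩
  (f ⊛ h) (suc n) + (g ⊛ h) (suc n)
    ∎
  where open ≡-Reasoning

·-⊛-assoc : ∀ a f g → a · f ⊛ g ≗ a · (f ⊛ g)
·-⊛-assoc a f g zero    = *-assoc a (f 0) (g 0)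
·-⊛-assoc a f g (suc n) = begin
  a * f 0 * g (suc n) + (a · (f ∘ suc) ⊛ g) n
    ≡⟨ cong₂ _+_ (*-assoc a (f 0) (g (suc n))) (·-⊛-assoc a (f ∘ suc) g n) ⟩
  a * (f 0 * g (suc n)) + a * (f ∘ suc ⊛ g) n
    ≡⟨ *-distribˡ-+ a (f 0 * g (suc n)) ((f ∘ suc ⊛ g) n) ⟨
  a * (f ⊛ g) (suc n)
    ∎
  where open ≡-Reasoning

-- The tail of a product: (f ⊛ g) ∘ suc is definitionally f 0 · (g ∘ suc) ⊕ (f ∘ suc) ⊛ g.
⊛-assoc : ∀ f g h → (f ⊛ g) ⊛ h ≗ f ⊛ (g ⊛ h)
⊛-assoc f g h zero    = *-assoc (f 0) (g 0) (h 0)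
⊛-assoc f g h (suc n) = begin
  f 0 * g 0 * h (suc n) + ((f 0 · (g ∘ suc) ⊕ f ∘ suc ⊛ g) ⊛ h) n
    ≡⟨ cong (f 0 * g 0 * h (suc n) +_) (⊛-distribʳ-⊕ h (f 0 · (g ∘ suc)) (f ∘ suc ⊛ g) n) ⟩
  f 0 * g 0 * h (suc n) + ((f 0 · (g ∘ suc) ⊛ h) n + (f ∘ suc ⊛ g ⊛ h) n)
    ≡⟨ cong₂ (λ u v → f 0 * g 0 * h (suc n) + (u + v)) (·-⊛-assoc (f 0) (g ∘ suc) h n) (⊛-assoc (f ∘ suc) g h n) ⟩
  f 0 * g 0 * h (suc n) + (f 0 * (g ∘ suc ⊛ h) n + (f ∘ suc ⊛ (g ⊛ h)) n)
    ≡⟨ solve 5 (λ a b c d e → a :* b :* c :+ (a :* d :+ e) := a :* (b :* c :+ d) :+ e) refl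
         (f 0) (g 0) (h (suc n)) ((g ∘ suc ⊛ h) n) ((f ∘ suc ⊛ (g ⊛ h)) n) ⟩
  f 0 * (g ⊛ h) (suc n) + (f ∘ suc ⊛ (g ⊛ h)) n
    ∎
  where open ≡-Reasoning

reverse-applyDownFrom : ∀ {A : Set} (f : ℕ → A) n → reverse (applyDownFrom f n) ≡ applyUpTo f n
reverse-applyDownFrom f zero    = refl
reverse-applyDownFrom f (suc n) = begin
  reverse (f n ∷ applyDownFrom f n)   ≡⟨ unfold-reverse (f n) (applyDownFrom f n) ⟩
  reverse (applyDownFrom f n) ∷ʳ f n  ≡⟨ cong (_∷ʳ f n) (reverse-applyDownFrom f n) ⟩
  applyUpTo f n ∷ʳ f n                ≡⟨ applyUpTo-∷ʳ f n ⟩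
  applyUpTo f (suc n)                 ∎
  where open ≡-Reasoning

sum-zipWith-applyUpTo-applyDownFrom : ∀ f g n →
  sum (zipWith _*_ (applyUpTo f (suc n)) (applyDownFrom g (suc n))) ≡ (f ⊛ g) n
sum-zipWith-applyUpTo-applyDownFrom f g zero    = +-identityʳ (f 0 * g 0)
sum-zipWith-applyUpTo-applyDownFrom f g (suc n) = cong (f 0 * g (suc n) +_) (sum-zipWith-applyUpTo-applyDownFrom (f ∘ suc) g n)

R : Series
R = largeSchröder

schTable≡applyDownFrom : ∀ n → schTable n ≡ applyDownFrom R (suc n)
schTable≡applyDownFrom zero    = refl
schTable≡applyDownFrom (suc n) = cong (R (suc n) ∷_) (schTable≡applyDownFrom n)

R-suc : R ∘ suc ≗ R ⊕ R ⊛ R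
R-suc n = cong (R n +_) (begin
  sum (zipWith _*_ (schTable n) (reverse (schTable n)))  ≡⟨ cong (λ t → sum (zipWith _*_ t (reverse t))) (schTable≡applyDownFrom n) ⟩
  sum (zipWith _*_ down (reverse down))                  ≡⟨ cong (sum ∘ zipWith _*_ down) (reverse-applyDownFrom R (suc n)) ⟩
  sum (zipWith _*_ down up)                              ≡⟨ cong sum (zipWith-comm _*_ *-comm down up) ⟩
  sum (zipWith _*_ up down)                              ≡⟨ sum-zipWith-applyUpTo-applyDownFrom R R n ⟩
  (R ⊛ R) n                                              ∎)
  where
  open ≡-Reasoning
  down up : List ℕ
  down = applyDownFrom R (suc n)
  up   = applyUpTo R (suc n)

R-suc-⊛ : ∀ f → R ∘ suc ⊛ f ≗ R ⊛ f ⊕ R ⊛ (R ⊛ f)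
R-suc-⊛ f n = begin
  (R ∘ suc ⊛ f) n              ≡⟨ ⊛-congʳ f R-suc n ⟩
  ((R ⊕ R ⊛ R) ⊛ f) n          ≡⟨ ⊛-distribʳ-⊕ f R (R ⊛ R) n ⟩
  (R ⊛ f) n + (R ⊛ R ⊛ f) n    ≡⟨ cong ((R ⊛ f) n +_) (⊛-assoc R R f n) ⟩
  (R ⊛ f) n + (R ⊛ (R ⊛ f)) n  ∎
  where open ≡-Reasoning

K : ℕ → Series
K zero    = R
K (suc ℓ) = K ℓ ⊕ R ⊛ K ℓ

K-recurrence : SchröderRecurrence (λ n ℓ → K ℓ n)
K-recurrence = record { top = top ; left = R-suc ; step = step }
  where
  open ≡-Reasoning
  top : ∀ ℓ → K ℓ 0 ≡ 2 ^ ℓ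
  top zero    = refl
  top (suc ℓ) = cong (2 *_) (top ℓ)
  step : ∀ n ℓ → K (suc ℓ) (suc n) + K (suc ℓ) n ≡ 2 * K ℓ (suc n) + K (suc (suc ℓ)) n
  step n ℓ = begin
    (a + (1 * a + (R ∘ suc ⊛ K ℓ) n)) + K (suc ℓ) n
      ≡⟨ cong (λ u → (a + (1 * a + u)) + K (suc ℓ) n) (R-suc-⊛ (K ℓ) n) ⟩
    (a + (1 * a + (x + y))) + K (suc ℓ) n
      ≡⟨ solve 4 (λ a b x y → (a :+ (con 1 :* a :+ (x :+ y))) :+ b := con 2 :* a :+ (b :+ (x :+ y))) refl
           a (K (suc ℓ) n) x y ⟩
    2 * a + (K (suc ℓ) n + (x + y))
      ≡⟨ cong (λ u → 2 * a + (K (suc ℓ) n + u)) (⊛-distribˡ-⊕ R (K ℓ) (R ⊛ K ℓ) n) ⟨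
    2 * a + K (suc (suc ℓ)) n
      ∎
    where
    a x y : ℕ
    a = K ℓ (suc n)
    x = (R ⊛ K ℓ) n
    y = (R ⊛ (R ⊛ K ℓ)) n

theorem3 : (n : ℕ) → 1 ≤ n → c n ≡ largeSchröder (n ∸ 1)
theorem3 zero    ()
theorem3 (suc n) _ = begin
  length (generation n)                   ≡⟨ length-generation n ⟩
  levelSize children n (1 , 1)            ≡⟨ levelSize-children n 0 0 ⟩
  levelSize children₁ n 0                 ≡⟨ *-identityˡ _ ⟨
  2 ^ 0 * levelSize children₁ n 0         ≡⟨ SchröderRecurrence-unique scaledLevelSize-recurrence K-recurrence n 0 ⟩
  K 0 n                                   ∎
  where open ≡-Reasoning
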